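{- In the internal logic of $\mathcal{S}$ the following holds: $\forall\,\phi:\Omega^{\mathbb{K}}.\ \big(\forall\,\kappa:\mathbb{K}.\ \triangleright^{\kappa}\phi(\kappa)\big)\Rightarrow\forall\,\kappa:\mathbb{K}.\ \phi(\kappa)$.
   Context: Let $\mathbb{F}^+$ be the category whose objects are $\bullet^n$ for $n>0$ (free category with strictly associative binary products on one object); a morphism $\bullet^n\to\bullet^m$ is equivalently a function $\{0,\dots,m-1\}\to\{0,\dots,n-1\}$. Let $\mathcal{N}=\mathrm{Hom}_{\mathbb{F}^+}(-,\bullet^1)$. For $U\in\mathbb{F}^+$ let $\mathrm{CLK}[U]=\omega^{\mathcal{N}(U)}$ ordered pointwise, with $\mathrm{CLK}[f](\partial_V)=(\kappa\mapsto\partial_V(f^*\kappa))$ for $f:V\to U$. The category $\mathbb{CLK}$ has objects $\mathbf{U}=(U,\partial_U)$, $\partial_U\in\mathrm{CLK}[U]$, and morphisms $f:(V,\partial_V)\to(U,\partial_U)$ the $\mathbb{F}^+$-maps $f:V\to U$ with $\mathrm{CLK}[f](\partial_V)\le\partial_U$. $\mathcal{S}$ is the presheaf topos on $\mathbb{CLK}$; the clock object is $\mathbb{K}(U,\partial_U)=\mathcal{N}(U)$. Write $\mathbf{U}[\kappa\mapsto n]$ for $(U,\partial_U[\kappa\mapsto n])$ and $[\kappa\mathrel{+}=1]:\mathbf{U}\to\mathbf{U}[\kappa\mapsto\partial_U(\kappa)+1]$ for the morphism whose underlying $\mathbb{F}^+$-map is the identity. For $\kappa\in\mathbb{K}(\mathbf{U})$,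 a subobject $\phi$ of $X$ and $\alpha\in X(\mathbf{U})$, the later modality is defined by its Kripke–Joyal forcing clause: $\mathbf{U}\Vdash\triangleright^{\kappa}\phi(\alpha)$ holds iff either $\partial_U(\kappa)=0$, or $\partial_U(\kappa)=n+1$ and $\mathbf{U}[\kappa\mapsto n]\Vdash\phi([\kappa\mathrel{+}=1]^*\alpha)$. All other connectives have their standard Kripke–Joyal interpretation. -}

module Defs where

open import Data.Nat using (ℕ; zero; suc; _≤_)
open import Data.Nat.Properties using (≤-refl; ≤-trans; n≤1+n; ≤-reflexive)
open import Data.Fin using (Fin; _≟_)
open import Data.Unit using (⊤)
open import Relation.Nullary using (yes; no)
open import Relation.Binary.PropositionalEquality using (_≡_; refl; sym)

-- Objects of 𝕮𝕃𝕂: (U, ∂_U) with U = •^(suc n) ∈ 𝔽⁺ (so arity > 0)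
-- and ∂_U ∈ CLK[U] = ω^{𝒩(U)}; here 𝒩(•^(suc n)) = Hom(•^(suc n), •^1) ≅ Fin (suc n).
record Obj : Set where
  constructor obj
  field
    ar : ℕ
    ∂  : Fin (suc ar) → ℕ
open Obj public

K : Obj → Set
K U = Fin (suc (ar U))

-- A morphism f : V → U of 𝕮𝕃𝕂 is an 𝔽⁺-map •^m → •^n, i.e. a function
-- {0..|U|-1} → {0..|V|-1}, with CLK[f](∂_V) ≤ ∂_U pointwise.
-- f^*κ for κ ∈ 𝒩(U) is (fun f κ).
record Hom (V U : Obj) : Set where
  constructor hom
  field
    fun : K U → K V
    .le : (κ : K U) → ∂ V (fun κ) ≤ ∂ U κ
open Hom public

idH : (U : Obj) → Hom U U
idH U = hom (λ κ → κ) (λ κ → ≤-refl)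

_∘H_ : {W V U : Obj} → Hom V U → Hom W V → Hom W U
_∘H_ (hom f lf) (hom g lg) = hom (λ κ → g (f κ)) (λ κ → ≤-trans (lg (f κ)) (lf κ))

_^*K_ : {V U : Obj} → Hom V U → K U → K V
f ^*K κ = fun f κ

-- Ω^𝕂 at stage V: subpresheaves of y(V) × 𝕂
record ΩK (V : Obj) : Set₁ where
  field
    P     : (W : Obj) → Hom W V → K W → Set
    restr : {W W' : Obj} (g : Hom W V) (h : Hom W' W) (κ : K W) →
            P W g κ → P W' (g ∘H h) (h ^*K κ)
open ΩK public

restrictΩ : {W V : Obj} → Hom W V → ΩK V → ΩK W
restrictΩ f φ = record
  { P = λ W' g κ → P φ W' (f ∘H g) κ
  ; restr = λ g h κ p → restr φ (f ∘H g) h κ p }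

-- U ⊩ φ(κ)  (evaluation of φ : Ω^𝕂 at κ : 𝕂, at stage U)
Ev : (U : Obj) → ΩK U → K U → Set
Ev U φ κ = P φ U (idH U) κ

upd : (U : Obj) → K U → ℕ → Obj
upd U κ m = obj (ar U) (λ κ' → f κ' (κ' ≟ κ))
  where
  f : (κ' : K U) → _ → ℕ
  f κ' (yes _) = m
  f κ' (no _)  = ∂ U κ'

tick : (U : Obj) (κ : K U) (m : ℕ) → ∂ U κ ≡ suc m → Hom (upd U κ m) U
tick U κ m eq = hom (λ κ' → κ') lem
  where
  lem : (κ' : K U) → ∂ (upd U κ m) κ' ≤ ∂ U κ'
  lem κ' with κ' ≟ κ
  ... | yes refl = ≤-trans (n≤1+n m) (≤-reflexive (sym eq))
  ... | no _ = ≤-refl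

-- U ⊩ ▷^κ φ(κ)  (Kripke–Joyal clause of the later modality)
Later : (U : Obj) → ΩK U → K U → Set
Later U φ κ = go (∂ U κ) refl
  where
  go : (n : ℕ) → ∂ U κ ≡ n → Set
  go zero    _  = ⊤
  go (suc m) eq = Ev (upd U κ m) (restrictΩ (tick U κ m eq) φ) (tick U κ m eq ^*K κ)

ForcesAllLater : (W : Obj) → ΩK W → Set
ForcesAllLater W φ = (W' : Obj) (k : Hom W' W) (κ : K W') → Later W' (restrictΩ k φ) κ

ForcesAll : (W : Obj) → ΩK W → Set
ForcesAll W φ = (W' : Obj) (k : Hom W' W) (κ : K W') → Ev W' (restrictΩ k φ) κ

ForcesImp : (W : Obj) → ΩK W → Set
ForcesImp W φ = (W' : Obj) (h : Hom W' W) →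
  ForcesAllLater W' (restrictΩ h φ) → ForcesAll W' (restrictΩ h φ)

ForcesStatement : Obj → Set₁
ForcesStatement V = (W : Obj) (f : Hom W V) (φ : ΩK W) → ForcesImp W φ

module Submission where

-- To force φ(κ) at W we adjoin to W a
-- fresh clock ν whose counter is one tick ahead of κ, namely ∂(κ) + 1; the
-- projection W⁺ → W forgets ν. At W⁺ the hypothesis gives ▷^ν φ(ν), and since
-- ∂(ν) is a successor this unfolds to φ(ν) at W⁺[ν ↦ ∂(κ)]. That stage
-- receives a map from W which sends ν to κ and fixes every other clock; it is
-- a morphism precisely because ∂(ν) was decremented to ∂(κ). Restricting along
-- it turns φ(ν) into φ(κ) at W, because the composite W → W⁺[ν ↦ ∂(κ)] → W⁺ → W
-- is the identity on clocks.

open import Defs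
open import Data.Nat using (ℕ; suc; _≤_)
open import Data.Nat.Properties using (≤-refl)
open import Data.Fin using (Fin; zero; suc; _≟_)
open import Relation.Nullary using (no)
open import Relation.Binary.PropositionalEquality using (refl)

extend : (W : Obj) → K W → Obj
extend W κ = obj (suc (ar W)) counter
  where
  counter : Fin (suc (suc (ar W))) → ℕ
  counter zero    = suc (∂ W κ)
  counter (suc c) = ∂ W c

fresh : (W : Obj) (κ : K W) → K (extend W κ)
fresh W κ = zero

forget : (W : Obj) (κ : K W) → Hom (extend W κ) W
forget W κ = hom suc (λ _ → ≤-refl)

ticked : (W : Obj) (κ : K W) → Obj
ticked W κ = upd (extend W κ) (fresh W κ) (∂ W κ)

-- The map W → W⁺[ν ↦ ∂(κ)] substituting κ for ν. It is a morphism because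
-- the ticked counter of ν is ∂(κ) and all other counters are those of W.
substitute : (W : Obj) (κ : K W) → Hom W (ticked W κ)
substitute W κ = hom rename counterBound
  where
  rename : K (extend W κ) → K W
  rename zero    = κ
  rename (suc c) = c

  counterBound : (c : K (extend W κ)) → ∂ W (rename c) ≤ ∂ (ticked W κ) c
  counterBound zero = ≤-refl
  counterBound (suc c) with suc c ≟ zero
  ... | no _ = ≤-refl

-- Since ∂(ν) = ∂(κ) + 1, the later clause unfolds to φ(ν) at the ticked
-- stage; restricting along substitute yields φ(κ), because
-- forget ∘ tick ∘ substitute is the identity on the clocks of W.
laterAtFreshClock : (W : Obj) (κ : K W) (φ : ΩK W) →
  Later (extend W κ) (restrictΩ (forget W κ) φ) (fresh W κ) → Ev W φ κ
laterAtFreshClock W κ φ laterφ =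
  restr (restrictΩ tickν (restrictΩ (forget W κ) φ))
        (idH (ticked W κ)) (substitute W κ) (fresh W κ) laterφ
  where
  tickν : Hom (ticked W κ) (extend W κ)
  tickν = tick (extend W κ) (fresh W κ) (∂ W κ) refl

mainTheorem3 : (V : Obj) → ForcesStatement V
mainTheorem3 V W f φ W' h allLater W'' k κ =
  laterAtFreshClock W'' κ (restrictΩ k (restrictΩ h φ))
    (allLater (extend W'' κ) (k ∘H forget W'' κ) (fresh W'' κ))
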